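{- Let $G=(V,E)$ be a finite simple graph of order $n$. Let $(x,z)$ with $x\in\{0,1\}^{n\times V}$ (entries $x_{iu}$, $i\in\{1,\ldots,n\}$, $u\in V$) and $z\in\{0,1\}^n$ satisfy (1) $z_i-\sum_{u\in V}x_{iu}\le0$ for all $i\in\{1,\ldots,n\}$; (2) $x_{iu}-x_{iv}+\sum_{w\in N(u)\setminus\{v\}}x_{iw}\ge0$ for all $i\in\{1,\ldots,n\}$, $v\in V$, $u\in N(v)$; (3) $\sum_{i=1}^n x_{iu}\le1$ for all $u\in V$. Then there is a collection $\mathcal{F}$ of pairwise disjoint forts of $G$ with $|\mathcal{F}|=\sum_{i=1}^n z_i$.
   Context: $N(u)$ is the neighborhood of $u$. A fort of $G$ is a non-empty set $F\subseteq V$ such that no vertex $u\in V\setminus F$ has exactly one neighbor in $F$. -}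

module Defs where

open import Data.Nat using (ℕ; _+_; _≤_)
open import Data.Bool using (Bool; true; false; if_then_else_; _∧_)
open import Data.Fin using (Fin)
open import Data.Fin.Properties using (_≟_)
open import Data.List using (List; length; lookup)
open import Data.Product using (∃; _×_)
open import Relation.Binary.PropositionalEquality using (_≡_; _≢_)
open import Relation.Nullary using (¬_)
open import Relation.Nullary.Decidable using (⌊_⌋)
open import Data.Bool using (not)

Σ[_] : ∀ {n} → (Fin n → ℕ) → ℕ
Σ[_] {ℕ.zero} f = 0
Σ[_] {ℕ.suc n} f = f Fin.zero + Σ[_] {n} (λ i → f (Fin.suc i))

⟦_⟧ : Bool → ℕ
⟦ true ⟧ = 1
⟦ false ⟧ = 0

record Graph (n : ℕ) : Set where
  field
    adj   : Fin n → Fin n → Bool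
    sym   : ∀ u v → adj u v ≡ adj v u
    irrefl : ∀ u → adj u u ≡ false
open Graph public

VSet : ℕ → Set
VSet n = Fin n → Bool

nbrsIn : ∀ {n} → Graph n → VSet n → Fin n → ℕ
nbrsIn G F u = Σ[ (λ w → ⟦ adj G u w ∧ F w ⟧) ]

IsFort : ∀ {n} → Graph n → VSet n → Set
IsFort G F = (∃ λ u → F u ≡ true) × (∀ u → F u ≡ false → ¬ (nbrsIn G F u ≡ 1))

Disjoint : ∀ {n} → VSet n → VSet n → Set
Disjoint F H = ∀ u → ¬ (F u ≡ true × H u ≡ true)

-- A collection of pairwise disjoint forts, given as a list (distinct
-- positions are pairwise disjoint, hence the collection's size is its length).
PairwiseDisjointForts : ∀ {n} → Graph n → List (VSet n) → Set
PairwiseDisjointForts G 𝓕 =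
  (∀ k → IsFort G (lookup 𝓕 k)) ×
  (∀ k l → k ≢ l → Disjoint (lookup 𝓕 k) (lookup 𝓕 l))

Cons1 : ∀ {n} → (Fin n → Fin n → Bool) → (Fin n → Bool) → Set
Cons1 x z = ∀ i → ⟦ z i ⟧ ≤ Σ[ (λ u → ⟦ x i u ⟧) ]

Cons2 : ∀ {n} → Graph n → (Fin n → Fin n → Bool) → Set
Cons2 G x = ∀ i v u → adj G v u ≡ true →
  ⟦ x i v ⟧ ≤ ⟦ x i u ⟧ + Σ[ (λ w → ⟦ adj G u w ∧ not ⌊ w ≟ v ⌋ ∧ x i w ⟧) ]

Cons3 : ∀ {n} → (Fin n → Fin n → Bool) → Set
Cons3 x = ∀ u → Σ[ (λ i → ⟦ x i u ⟧) ] ≤ 1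

{-# OPTIONS --safe #-}
-- Every row x_i with z_i = 1 is a fort: it is non-empty by (1), and if a vertex
-- u outside x_i has a neighbour v in x_i, then (2) for the edge (v, u) yields a
-- second neighbour of u in x_i. By (3) no vertex lies in two rows, so the rows
-- selected by z are pairwise disjoint forts, and there are Σ z_i of them.
module Submission where

open import Defs hiding (sym)
open import Data.Nat using (ℕ; zero; suc; _+_; _≤_; z≤n; s≤s; s≤s⁻¹)
open import Data.Nat.Properties using (≤-trans; ≤-reflexive; m≤n+m; n≮0)
open import Data.Bool using (Bool; true; false; T; T?; _∧_; not)
open import Data.Bool.Properties using (T-≡)
open import Data.Fin using (Fin)
open import Data.Fin.Properties using (_≟_)
open import Data.List using (List; length; lookup; map; tabulate; filterᵇ; allFin)
open import Data.List.Properties using (length-map)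
open import Data.List.Membership.Propositional.Properties using (∈-lookup)
open import Data.List.Relation.Unary.All as All using (All)
import Data.List.Relation.Unary.All.Properties as All
open import Data.List.Relation.Unary.AllPairs as AllPairs using (AllPairs; _∷_)
import Data.List.Relation.Unary.AllPairs.Properties as AllPairs
open import Data.List.Relation.Unary.Unique.Propositional.Properties using (allFin⁺; filter⁺)
open import Data.Product using (∃; _×_; _,_)
open import Data.Empty using (⊥-elim)
open import Function using (_∘_; id; Equivalence)
open import Relation.Binary using (Rel; Symmetric)
open import Relation.Binary.PropositionalEquality using (_≡_; _≢_; refl; sym; trans; cong; subst; subst₂)
open import Relation.Nullary using (¬_)
open import Relation.Nullary.Decidable using (⌊_⌋; toWitnessFalse)

count : ∀ {n} → (Fin n → Bool) → ℕ
count b = Σ[ (λ i → ⟦ b i ⟧) ]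

true⇒1≤count : ∀ {n} (b : Fin n → Bool) i → b i ≡ true → 1 ≤ count b
true⇒1≤count b Fin.zero bi rewrite bi = s≤s z≤n
true⇒1≤count b (Fin.suc i) bi =
  ≤-trans (true⇒1≤count (b ∘ Fin.suc) i bi) (m≤n+m _ ⟦ b Fin.zero ⟧)

1≤count⇒∃true : ∀ {n} (b : Fin n → Bool) → 1 ≤ count b → ∃ λ i → b i ≡ true
1≤count⇒∃true {suc n} b 1≤c with b Fin.zero in b0
... | true  = Fin.zero , b0
... | false with i , bi ← 1≤count⇒∃true (b ∘ Fin.suc) 1≤c = Fin.suc i , bi

count≤1⇒unique : ∀ {n} (b : Fin n → Bool) → count b ≤ 1 →
  ∀ i j → b i ≡ true → b j ≡ true → i ≡ j
count≤1⇒unique b c≤1 Fin.zero Fin.zero _ _ = refl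
count≤1⇒unique b c≤1 Fin.zero (Fin.suc j) b0 bj = ⊥-elim (n≮0 (≤-trans 1≤rest rest≤0))
  where
  1≤rest : 1 ≤ count (b ∘ Fin.suc)
  1≤rest = true⇒1≤count (b ∘ Fin.suc) j bj
  rest≤0 : count (b ∘ Fin.suc) ≤ 0
  rest≤0 = s≤s⁻¹ (subst (λ a → ⟦ a ⟧ + count (b ∘ Fin.suc) ≤ 1) b0 c≤1)
count≤1⇒unique b c≤1 (Fin.suc i) Fin.zero bi b0 =
  sym (count≤1⇒unique b c≤1 Fin.zero (Fin.suc i) b0 bi)
count≤1⇒unique b c≤1 (Fin.suc i) (Fin.suc j) bi bj =
  cong Fin.suc (count≤1⇒unique (b ∘ Fin.suc) (≤-trans (m≤n+m _ ⟦ b Fin.zero ⟧) c≤1) i j bi bj)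

length-filterᵇ-tabulate : ∀ {a} {A : Set a} {n} (p : A → Bool) (f : Fin n → A) →
  length (filterᵇ p (tabulate f)) ≡ count (p ∘ f)
length-filterᵇ-tabulate {n = zero}  p f = refl
length-filterᵇ-tabulate {n = suc n} p f with p (f Fin.zero)
... | true  = cong suc (length-filterᵇ-tabulate p (f ∘ Fin.suc))
... | false = length-filterᵇ-tabulate p (f ∘ Fin.suc)

AllPairs⇒lookup : ∀ {a ℓ} {A : Set a} {R : Rel A ℓ} → Symmetric R →
  ∀ {xs} → AllPairs R xs → ∀ k l → k ≢ l → R (lookup xs k) (lookup xs l)
AllPairs⇒lookup R-sym (Rx ∷ Rxs) Fin.zero    Fin.zero    k≢l = ⊥-elim (k≢l refl)
AllPairs⇒lookup R-sym (Rx ∷ Rxs) Fin.zero    (Fin.suc l) k≢l = All.lookup Rx (∈-lookup l)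
AllPairs⇒lookup R-sym (Rx ∷ Rxs) (Fin.suc k) Fin.zero    k≢l = R-sym (All.lookup Rx (∈-lookup k))
AllPairs⇒lookup R-sym (Rx ∷ Rxs) (Fin.suc k) (Fin.suc l) k≢l =
  AllPairs⇒lookup R-sym Rxs k l (k≢l ∘ cong Fin.suc)

∧≡true⁺ : ∀ {a b} → a ≡ true → b ≡ true → a ∧ b ≡ true
∧≡true⁺ refl refl = refl

∧≡true⁻ : ∀ a {b} → a ∧ b ≡ true → a ≡ true × b ≡ true
∧≡true⁻ true b≡true = refl , b≡true

Disjoint-sym : ∀ {n} → Symmetric (Disjoint {n})
Disjoint-sym F∩H u (Hu , Fu) = F∩H u (Fu , Hu)

module _ {n} (G : Graph n) where

  otherNbrsIn : VSet n → Fin n → Fin n → ℕ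
  otherNbrsIn F u v = count (λ w → adj G u w ∧ not ⌊ w ≟ v ⌋ ∧ F w)

  -- Cons2 G x is ∀ i → FortInequalities (x i).
  FortInequalities : VSet n → Set
  FortInequalities F = ∀ v u → adj G v u ≡ true → ⟦ F v ⟧ ≤ ⟦ F u ⟧ + otherNbrsIn F u v

  1≤otherNbrsIn : ∀ {F u v} → FortInequalities F → F u ≡ false → adj G u v ≡ true → F v ≡ true →
    1 ≤ otherNbrsIn F u v
  1≤otherNbrsIn {F} {u} {v} ineq Fu≡false uv Fv =
    subst₂ (λ a b → ⟦ a ⟧ ≤ ⟦ b ⟧ + otherNbrsIn F u v) Fv Fu≡false
      (ineq v u (trans (Graph.sym G v u) uv))

  second-neighbour : ∀ {F u v} → FortInequalities F → F u ≡ false → adj G u v ∧ F v ≡ true →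
    ∃ λ w → w ≢ v × adj G u w ∧ F w ≡ true
  second-neighbour {F} {u} {v} ineq Fu≡false uv∈F
    with uv , Fv ← ∧≡true⁻ (adj G u v) uv∈F
    with w , uw∈F∖v ← 1≤count⇒∃true _ (1≤otherNbrsIn ineq Fu≡false uv Fv)
    with uw , w≠v∧Fw ← ∧≡true⁻ (adj G u w) uw∈F∖v
    with w≠v , Fw ← ∧≡true⁻ (not ⌊ w ≟ v ⌋) w≠v∧Fw
    = w , toWitnessFalse (Equivalence.from T-≡ w≠v) , ∧≡true⁺ uw Fw

  fortInequalities⇒IsFort : ∀ {F} → 1 ≤ count F → FortInequalities F → IsFort G F
  fortInequalities⇒IsFort {F} 1≤|F| ineq = 1≤count⇒∃true F 1≤|F| , no-lonely-neighbour
    where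
    no-lonely-neighbour : ∀ u → F u ≡ false → ¬ (nbrsIn G F u ≡ 1)
    no-lonely-neighbour u Fu≡false nbrs≡1
      with v , uv∈F ← 1≤count⇒∃true (λ w → adj G u w ∧ F w) (≤-reflexive (sym nbrs≡1))
      with w , w≢v , uw∈F ← second-neighbour ineq Fu≡false uv∈F
      = w≢v (count≤1⇒unique _ (≤-reflexive nbrs≡1) w v uw∈F uv∈F)

rows-disjoint : ∀ {n} {x : Fin n → Fin n → Bool} → Cons3 x → ∀ {i j} → i ≢ j → Disjoint (x i) (x j)
rows-disjoint {x = x} c3 i≢j u (xiu , xju) = i≢j (count≤1⇒unique (λ i → x i u) (c3 u) _ _ xiu xju)

theorem7p1 : (n : ℕ) (G : Graph n) (x : Fin n → Fin n → Bool) (z : Fin n → Bool) →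
    Cons1 x z → Cons2 G x → Cons3 x →
    ∃ λ (𝓕 : List (VSet n)) →
      PairwiseDisjointForts G 𝓕 × length 𝓕 ≡ Σ[ (λ i → ⟦ z i ⟧) ]
theorem7p1 n G x z c1 c2 c3 = map x selected , (forts , disjoint) , size
  where
  selected : List (Fin n)
  selected = filterᵇ z (allFin n)

  selected-row-isFort : ∀ {i} → T (z i) → IsFort G (x i)
  selected-row-isFort {i} zi = fortInequalities⇒IsFort G
    (subst (λ b → ⟦ b ⟧ ≤ count (x i)) (Equivalence.to T-≡ zi) (c1 i)) (c2 i)

  selected-rows-forts : All (IsFort G) (map x selected)
  selected-rows-forts = All.map⁺ (All.map selected-row-isFort (All.all-filter (T? ∘ z) (allFin n)))

  selected-rows-disjoint : AllPairs Disjoint (map x selected)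
  selected-rows-disjoint = AllPairs.map⁺ (AllPairs.map (rows-disjoint c3) (filter⁺ (T? ∘ z) (allFin⁺ n)))

  forts : ∀ k → IsFort G (lookup (map x selected) k)
  forts k = All.lookup selected-rows-forts (∈-lookup k)

  disjoint : ∀ k l → k ≢ l → Disjoint (lookup (map x selected) k) (lookup (map x selected) l)
  disjoint = AllPairs⇒lookup Disjoint-sym selected-rows-disjoint

  size : length (map x selected) ≡ count z
  size = trans (length-map x selected) (length-filterᵇ-tabulate z id)
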